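{- For integers $k\ge 2$ and $x\ge 1$, $2^{(k-1)x-1}<m(k,x)\le x\cdot k^2\cdot 2^{(k+1)x+2}$.
   Context: A bicoloring of a hypergraph $G(V,E)$ is a map $X:V\to\{0,1\}$; a bicoloring cover of $G$ is a set of bicolorings such that every hyperedge is non-monochromatic under at least one of them. $m(k,x)$ denotes the smallest integer $m$ such that there exists a $k$-uniform hypergraph with $m$ hyperedges that has no bicoloring cover of size $x$. -}

module Defs where

open import Data.Nat using (ℕ)
open import Data.Bool using (Bool)
open import Data.Fin using (Fin)
open import Data.Fin.Subset using (Subset; _∈_; ∣_∣)
open import Data.Product using (∃; ∃-syntax; Σ-syntax; _×_)
open import Relation.Binary.PropositionalEquality using (_≡_; _≢_)
open import Relation.Nullary using (¬_)
open import Function.Definitions using (Injective)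

Bicoloring : ℕ → Set
Bicoloring n = Fin n → Bool

-- A hypergraph on vertex set Fin n with m hyperedges, given as an
-- indexed family of subsets (required injective below, i.e. distinct edges).
Hyperedges : ℕ → ℕ → Set
Hyperedges n m = Fin m → Subset n

IsUniformHypergraph : ∀ {n m} → ℕ → Hyperedges n m → Set
IsUniformHypergraph k E = Injective _≡_ _≡_ E × (∀ i → ∣ E i ∣ ≡ k)

NonMonochromatic : ∀ {n} → Bicoloring n → Subset n → Set
NonMonochromatic X e = ∃[ u ] ∃[ v ] (u ∈ e × v ∈ e × X u ≢ X v)

-- a family of x bicolorings (repetitions allowed, i.e. a set of at most x
-- bicolorings) is a bicoloring cover
IsBicoloringCover : ∀ {n m x} → (Fin x → Bicoloring n) → Hyperedges n m → Set
IsBicoloringCover {m = m} cs E = ∀ (i : Fin m) → ∃[ j ] NonMonochromatic (cs j) (E i)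

HasCoverOfSize : ∀ {n m} → ℕ → Hyperedges n m → Set
HasCoverOfSize {n} x E = ∃[ cs ] IsBicoloringCover {x = x} cs E

-- there is a k-uniform hypergraph with m hyperedges having no bicoloring
-- cover of size x.  m(k,x) is the least m with this property.
Witnesses-m : ℕ → ℕ → ℕ → Set
Witnesses-m k x m = ∃[ n ] Σ[ E ∈ Hyperedges n m ]
  (IsUniformHypergraph k E × ¬ HasCoverOfSize x E)

module Submission where

-- A family of x bicolorings is the same as a colour assignment giving every
-- vertex a colour in Colour x = Vec Bool x (2^x colours), and it is a cover iff
-- no edge is monochromatic under the assignment.  Both bounds are the
-- probabilistic method, carried out as exact counting over finite enumerations.
--
-- Lower bound (first moment).  Among all (2^x)^n assignments, an edge is
-- entirely of a given colour for a fraction (2^x)^{-k} of them, so with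
-- m ≤ 2^{(k-1)x-1} edges the average number of monochromatic (edge, colour)
-- pairs is at most 1/2 and some assignment has none.
--
-- Upper bound (random hypergraph).  On N = 2^x k² vertices draw
-- m = 2 (2^x)^k (1 + xN) k-tuples.  Every assignment has a colour class of at
-- least k² vertices (pigeonhole), holding at least fall(k², k) ≥ (k²)^k / 2
-- tuples of distinct vertices (Weierstrass' product inequality), so a random
-- tuple misses them all with probability at most 1 - 1/(2 (2^x)^k).  Bernoulli's
-- inequality and a union bound over the 2^{xN} assignments give a sequence of m
-- tuples that no assignment avoids; the supports of its tuples of distinct
-- vertices form a k-uniform hypergraph with at most m edges and no cover.

open import Defs

open import Data.Bool using (Bool; true; false; _∧_; _∨_; not; if_then_else_)
import Data.Bool.Properties as Boolₚ
open import Data.Bool.Solver using (module ∨-∧-Solver)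
open import Data.Empty using (⊥-elim)
open import Data.Fin using (Fin; zero; suc)
import Data.Fin as Fin
open import Data.Fin.Subset using (Subset; ∣_∣; Nonempty) renaming (_∈_ to _∈ₛ_)
open import Data.Fin.Subset.Properties using (nonempty?; Empty-unique; ∣⊥∣≡0)
open import Data.List using (List; []; _∷_; length; map; _++_; allFin; tabulate; deduplicate)
import Data.List as List
open import Data.List.Membership.Propositional using (_∈_)
open import Data.List.Membership.Propositional.Properties
  using (∈-++⁺ˡ; ∈-++⁺ʳ; ∈-map⁺; ∈-allFin; ∈-lookup; ∈-deduplicate⁺; ∈-deduplicate⁻)
open import Data.List.Properties using (length-tabulate; length-deduplicate)
import Data.List.Relation.Unary.All as All
open import Data.List.Relation.Unary.AllPairs using (_∷_)
open import Data.List.Relation.Unary.Any using (here; there; index)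
open import Data.List.Relation.Unary.Any.Properties using (lookup-index)
open import Data.List.Relation.Unary.Unique.Propositional using (Unique)
open import Data.List.Relation.Unary.Unique.DecPropositional.Properties using (deduplicate-!)
open import Data.Nat
  using (ℕ; zero; suc; _+_; _*_; _∸_; _^_; _≤_; _<_; _<?_; z≤n; s≤s; s≤s⁻¹; NonZero; >-nonZero)
open import Data.Nat.Properties
open import Data.Nat.Tactic.RingSolver using (solve-∀)
open import Data.Product using (∃-syntax; _×_; _,_; proj₁; proj₂)
open import Data.Sum using (_⊎_; inj₁; inj₂)
open import Data.Vec using (Vec; []; _∷_; lookup; replicate)
  renaming (tabulate to tabulateᵥ; here to hereₛ; there to thereₛ)
open import Data.Vec.Properties using (≡-dec; []=⇒lookup; lookup∘tabulate)
open import Function.Definitions using (Injective)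
open import Relation.Binary.Definitions using (DecidableEquality)
open import Relation.Binary.PropositionalEquality
open import Relation.Nullary using (Dec; does; yes; no; ¬_; contradiction)

private variable
  A B : Set
  n : ℕ

𝟙 : Bool → ℕ
𝟙 true  = 1
𝟙 false = 0

𝟙-∧ : ∀ a b → 𝟙 (a ∧ b) ≡ 𝟙 a * 𝟙 b
𝟙-∧ true  b = sym (+-identityʳ (𝟙 b))
𝟙-∧ false b = refl

𝟙≤1 : ∀ a → 𝟙 a ≤ 1
𝟙≤1 true  = s≤s z≤n
𝟙≤1 false = z≤n

𝟙≡0⇒false : ∀ {a} → 𝟙 a ≡ 0 → a ≡ false
𝟙≡0⇒false {false} _ = refl

𝟙>0⇒true : ∀ {a} → 0 < 𝟙 a → a ≡ true
𝟙>0⇒true {true} _ = refl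

∧-split : ∀ {a b} → a ∧ b ≡ true → (a ≡ true) × (b ≡ true)
∧-split {true} {true} _ = refl , refl

∑ : List A → (A → ℕ) → ℕ
∑ []      f = 0
∑ (a ∷ l) f = f a + ∑ l f

∑-cong : ∀ (l : List A) {f g : A → ℕ} → (∀ a → f a ≡ g a) → ∑ l f ≡ ∑ l g
∑-cong []      e = refl
∑-cong (a ∷ l) e = cong₂ _+_ (e a) (∑-cong l e)

∑-mono : ∀ (l : List A) {f g : A → ℕ} → (∀ a → f a ≤ g a) → ∑ l f ≤ ∑ l g
∑-mono []      e = z≤n
∑-mono (a ∷ l) e = +-mono-≤ (e a) (∑-mono l e)

∑-+ : ∀ (l : List A) (f g : A → ℕ) → ∑ l (λ a → f a + g a) ≡ ∑ l f + ∑ l g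
∑-+ []      f g = refl
∑-+ (a ∷ l) f g = begin
  f a + g a + ∑ l (λ a → f a + g a) ≡⟨ cong (f a + g a +_) (∑-+ l f g) ⟩
  f a + g a + (∑ l f + ∑ l g)        ≡⟨ +-interchange (f a) (g a) (∑ l f) (∑ l g) ⟩
  f a + ∑ l f + (g a + ∑ l g)        ∎
  where
  open ≡-Reasoning
  +-interchange : ∀ a b c d → a + b + (c + d) ≡ a + c + (b + d)
  +-interchange = solve-∀

∑-*ˡ : ∀ (l : List A) c (f : A → ℕ) → ∑ l (λ a → c * f a) ≡ c * ∑ l f
∑-*ˡ []      c f = sym (*-zeroʳ c)
∑-*ˡ (a ∷ l) c f = trans (cong (c * f a +_) (∑-*ˡ l c f)) (sym (*-distribˡ-+ c (f a) (∑ l f)))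

∑-*ʳ : ∀ (l : List A) c (f : A → ℕ) → ∑ l (λ a → f a * c) ≡ ∑ l f * c
∑-*ʳ l c f = trans (∑-cong l (λ a → *-comm (f a) c)) (trans (∑-*ˡ l c f) (*-comm c (∑ l f)))

∑-const : ∀ (l : List A) c → ∑ l (λ _ → c) ≡ length l * c
∑-const []      c = refl
∑-const (a ∷ l) c = cong (c +_) (∑-const l c)

∑-zero : ∀ (l : List A) → ∑ l (λ _ → 0) ≡ 0
∑-zero l = trans (∑-const l 0) (*-zeroʳ (length l))

length≡∑1 : ∀ (l : List A) → length l ≡ ∑ l (λ _ → 1)
length≡∑1 l = sym (trans (∑-const l 1) (*-identityʳ (length l)))

∑-swap : ∀ (l : List A) (r : List B) (h : A → B → ℕ) →
  ∑ l (λ a → ∑ r (h a)) ≡ ∑ r (λ b → ∑ l (λ a → h a b))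
∑-swap []      r h = sym (∑-zero r)
∑-swap (a ∷ l) r h =
  trans (cong (∑ r (h a) +_) (∑-swap l r h)) (sym (∑-+ r (h a) (λ b → ∑ l (λ a → h a b))))

∑-map : ∀ (l : List A) (g : A → B) (f : B → ℕ) → ∑ (map g l) f ≡ ∑ l (λ a → f (g a))
∑-map []      g f = refl
∑-map (a ∷ l) g f = cong (f (g a) +_) (∑-map l g f)

∑-++ : ∀ (l r : List A) (f : A → ℕ) → ∑ (l ++ r) f ≡ ∑ l f + ∑ r f
∑-++ []      r f = refl
∑-++ (a ∷ l) r f = trans (cong (f a +_) (∑-++ l r f)) (sym (+-assoc (f a) (∑ l f) (∑ r f)))

term≤∑ : ∀ (l : List A) (f : A → ℕ) {a} → a ∈ l → f a ≤ ∑ l f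
term≤∑ (b ∷ l) f (here refl) = m≤m+n (f b) (∑ l f)
term≤∑ (b ∷ l) f (there a∈l) = ≤-trans (term≤∑ l f a∈l) (m≤n+m (∑ l f) (f b))

∑≡0⇒term≡0 : ∀ (l : List A) (f : A → ℕ) → ∑ l f ≡ 0 → ∀ {a} → a ∈ l → f a ≡ 0
∑≡0⇒term≡0 l f s a∈l = n≤0⇒n≡0 (subst (_ ≤_) s (term≤∑ l f a∈l))

∑>0⇒term>0 : ∀ (l : List A) (f : A → ℕ) → 0 < ∑ l f → ∃[ a ] (a ∈ l × 0 < f a)
∑>0⇒term>0 (a ∷ l) f pos with f a in eq
... | suc _ = a , here refl , subst (0 <_) (sym eq) (s≤s z≤n)
... | zero with ∑>0⇒term>0 l f pos
...   | b , b∈l , fb>0 = b , there b∈l , fb>0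

∑<length⇒term≡0 : ∀ (l : List A) (f : A → ℕ) → ∑ l f < length l → ∃[ a ] (a ∈ l × f a ≡ 0)
∑<length⇒term≡0 (a ∷ l) f lt with f a in eq
... | zero = a , here refl , eq
... | suc v with ∑<length⇒term≡0 l f (≤-trans (s≤s (m≤n+m (∑ l f) v)) (s≤s⁻¹ lt))
...   | b , b∈l , fb≡0 = b , there b∈l , fb≡0

reaches⊎below : ∀ (l : List A) (f : A → ℕ) L → (∃[ a ] (L ≤ f a)) ⊎ (∑ l f + length l ≤ length l * L)
reaches⊎below []      f L = inj₂ z≤n
reaches⊎below (a ∷ l) f L with L ≤? f a | reaches⊎below l f L
... | yes L≤fa | _        = inj₁ (a , L≤fa)
... | no  _    | inj₁ hit = inj₁ hit
... | no  L≰fa | inj₂ le  = inj₂ (begin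
      f a + ∑ l f + suc (length l)   ≡⟨ shuffle (f a) (∑ l f) (length l) ⟩
      suc (f a) + (∑ l f + length l) ≤⟨ +-mono-≤ (≰⇒> L≰fa) le ⟩
      L + length l * L               ∎)
  where
  open ≤-Reasoning
  shuffle : ∀ a b c → a + b + suc c ≡ suc a + (b + c)
  shuffle = solve-∀

pigeonhole : ∀ (l : List A) (f : A → ℕ) L → 0 < length l → length l * L ≤ ∑ l f → ∃[ a ] (L ≤ f a)
pigeonhole l f L nonempty big with reaches⊎below l f L
... | inj₁ hit   = hit
... | inj₂ small = ⊥-elim (<⇒≱ (begin-strict
      ∑ l f            ≡⟨ +-comm 0 (∑ l f) ⟩
      ∑ l f + 0        <⟨ +-monoʳ-< (∑ l f) nonempty ⟩
      ∑ l f + length l ≤⟨ small ⟩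
      length l * L     ∎) big)
  where open ≤-Reasoning

prependAll : List A → List (Vec A n) → List (Vec A (suc n))
prependAll []      vs = []
prependAll (a ∷ l) vs = map (a ∷_) vs ++ prependAll l vs

allVec : List A → (n : ℕ) → List (Vec A n)
allVec l zero    = [] ∷ []
allVec l (suc n) = prependAll l (allVec l n)

∑-prependAll : ∀ (l : List A) (vs : List (Vec A n)) (f : Vec A (suc n) → ℕ) →
  ∑ (prependAll l vs) f ≡ ∑ l (λ a → ∑ vs (λ v → f (a ∷ v)))
∑-prependAll []      vs f = refl
∑-prependAll (a ∷ l) vs f = begin
  ∑ (map (a ∷_) vs ++ prependAll l vs) f         ≡⟨ ∑-++ (map (a ∷_) vs) (prependAll l vs) f ⟩
  ∑ (map (a ∷_) vs) f + ∑ (prependAll l vs) f     ≡⟨ cong₂ _+_ (∑-map vs (a ∷_) f) (∑-prependAll l vs f) ⟩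
  ∑ vs (λ v → f (a ∷ v)) + ∑ l (λ b → ∑ vs (λ v → f (b ∷ v))) ∎
  where open ≡-Reasoning

∑-allVec-suc : ∀ (l : List A) n (f : Vec A (suc n) → ℕ) →
  ∑ (allVec l (suc n)) f ≡ ∑ l (λ a → ∑ (allVec l n) (λ v → f (a ∷ v)))
∑-allVec-suc l n f = ∑-prependAll l (allVec l n) f

∈-prependAll : ∀ (l : List A) (vs : List (Vec A n)) {a v} → a ∈ l → v ∈ vs → (a ∷ v) ∈ prependAll l vs
∈-prependAll (b ∷ l) vs (here refl) v∈vs = ∈-++⁺ˡ (∈-map⁺ (b ∷_) v∈vs)
∈-prependAll (b ∷ l) vs (there a∈l) v∈vs = ∈-++⁺ʳ (map (b ∷_) vs) (∈-prependAll l vs a∈l v∈vs)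

∈-allVec : ∀ (l : List A) → (∀ a → a ∈ l) → (v : Vec A n) → v ∈ allVec l n
∈-allVec l complete []      = here refl
∈-allVec l complete (a ∷ v) = ∈-prependAll l _ (complete a) (∈-allVec l complete v)

∏ : (A → ℕ) → Vec A n → ℕ
∏ g []      = 1
∏ g (a ∷ v) = g a * ∏ g v

∑-∏ : ∀ (l : List A) n (g : A → ℕ) → ∑ (allVec l n) (∏ g) ≡ ∑ l g ^ n
∑-∏ l zero    g = refl
∑-∏ l (suc n) g = begin
  ∑ (allVec l (suc n)) (∏ g)                      ≡⟨ ∑-allVec-suc l n (∏ g) ⟩
  ∑ l (λ a → ∑ (allVec l n) (λ v → g a * ∏ g v))  ≡⟨ ∑-cong l (λ a → ∑-*ˡ (allVec l n) (g a) (∏ g)) ⟩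
  ∑ l (λ a → g a * ∑ (allVec l n) (∏ g))          ≡⟨ ∑-cong l (λ a → cong (g a *_) (∑-∏ l n g)) ⟩
  ∑ l (λ a → g a * ∑ l g ^ n)                     ≡⟨ ∑-*ʳ l (∑ l g ^ n) g ⟩
  ∑ l g * ∑ l g ^ n                               ∎
  where open ≡-Reasoning

∏≡0⇒factor≡0 : ∀ (g : A → ℕ) (v : Vec A n) → ∏ g v ≡ 0 → ∃[ i ] (g (lookup v i) ≡ 0)
∏≡0⇒factor≡0 g (a ∷ v) ∏≡0 with m*n≡0⇒m≡0∨n≡0 (g a) ∏≡0
... | inj₁ ga≡0 = zero , ga≡0
... | inj₂ rest≡0 with ∏≡0⇒factor≡0 g v rest≡0
...   | i , gi≡0 = suc i , gi≡0

∏-1 : ∀ (v : Vec A n) → ∏ (λ _ → 1) v ≡ 1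
∏-1 []      = refl
∏-1 (a ∷ v) = trans (+-identityʳ (∏ (λ _ → 1) v)) (∏-1 v)

length-allVec : ∀ (l : List A) n → length (allVec l n) ≡ length l ^ n
length-allVec l n = begin
  length (allVec l n)                   ≡⟨ length≡∑1 (allVec l n) ⟩
  ∑ (allVec l n) (λ _ → 1)              ≡⟨ ∑-cong (allVec l n) (λ v → sym (∏-1 v)) ⟩
  ∑ (allVec l n) (∏ (λ _ → 1))          ≡⟨ ∑-∏ l n (λ _ → 1) ⟩
  ∑ l (λ _ → 1) ^ n                     ≡⟨ cong (_^ n) (sym (length≡∑1 l)) ⟩
  length l ^ n                          ∎
  where open ≡-Reasoning

ExactEnumeration : DecidableEquality A → List A → Set
ExactEnumeration {A} _≟_ l = ∀ (a : A) → ∑ l (λ b → 𝟙 (does (a ≟ b))) ≡ 1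

allVec-exact : ∀ (_≟_ : DecidableEquality A) (l : List A) → ExactEnumeration _≟_ l →
  ∀ n → ExactEnumeration (≡-dec _≟_) (allVec l n)
allVec-exact _≟_ l exact zero    []      = refl
allVec-exact {A} _≟_ l exact (suc n) (a ∷ v) = begin
  ∑ (allVec l (suc n)) (δᵥ (a ∷ v))                   ≡⟨ ∑-allVec-suc l n (δᵥ (a ∷ v)) ⟩
  ∑ l (λ b → ∑ vs (λ w → 𝟙 (does (a ≟ b) ∧ does (≡-dec _≟_ v w))))
    ≡⟨ ∑-cong l (λ b → ∑-cong vs (λ w → 𝟙-∧ (does (a ≟ b)) (does (≡-dec _≟_ v w)))) ⟩
  ∑ l (λ b → ∑ vs (λ w → δ a b * δᵥ v w))
    ≡⟨ ∑-cong l (λ b → ∑-*ˡ vs (δ a b) (δᵥ v)) ⟩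
  ∑ l (λ b → δ a b * ∑ vs (δᵥ v))
    ≡⟨ ∑-cong l (λ b → cong (δ a b *_) (allVec-exact _≟_ l exact n v)) ⟩
  ∑ l (λ b → δ a b * 1)                               ≡⟨ ∑-*ʳ l 1 (δ a) ⟩
  ∑ l (δ a) * 1                                       ≡⟨ cong (_* 1) (exact a) ⟩
  1                                                   ∎
  where
  open ≡-Reasoning
  vs : List (Vec A n)
  vs = allVec l n
  δ : A → A → ℕ
  δ a b = 𝟙 (does (a ≟ b))
  δᵥ : ∀ {n} → Vec A n → Vec A n → ℕ
  δᵥ v w = 𝟙 (does (≡-dec _≟_ v w))

-- The colour of a vertex under a family of x bicolorings is the vector of its x colours.
Colour : ℕ → Set
Colour x = Vec Bool x

_≟ᶜ_ : ∀ {x} → DecidableEquality (Colour x)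
_≟ᶜ_ = ≡-dec Boolₚ._≟_

infix 4 _==ᶜ_
_==ᶜ_ : ∀ {x} → Colour x → Colour x → Bool
c ==ᶜ d = does (c ≟ᶜ d)

bools : List Bool
bools = true ∷ false ∷ []

∈-bools : ∀ b → b ∈ bools
∈-bools true  = here refl
∈-bools false = there (here refl)

bools-exact : ExactEnumeration Boolₚ._≟_ bools
bools-exact true  = refl
bools-exact false = refl

colours : (x : ℕ) → List (Colour x)
colours x = allVec bools x

∈-colours : ∀ {x} (c : Colour x) → c ∈ colours x
∈-colours = ∈-allVec bools ∈-bools

length-colours : ∀ x → length (colours x) ≡ 2 ^ x
length-colours = length-allVec bools

colours-exact : ∀ x → ExactEnumeration _≟ᶜ_ (colours x)
colours-exact = allVec-exact Boolₚ._≟_ bools bools-exact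

infix 4 _==_
_==_ : Fin n → Fin n → Bool
u == v = does (u Fin.≟ v)

∑-tabulate : ∀ n (g : Fin n → A) (f : A → ℕ) → ∑ (tabulate g) f ≡ ∑ (allFin n) (λ u → f (g u))
∑-tabulate zero    g f = refl
∑-tabulate (suc n) g f =
  cong (f (g zero) +_) (trans (∑-tabulate n (λ u → g (suc u)) f) (sym (∑-tabulate n suc (λ u → f (g u)))))

∑-allFin-suc : ∀ n (f : Fin (suc n) → ℕ) → ∑ (allFin (suc n)) f ≡ f zero + ∑ (allFin n) (λ u → f (suc u))
∑-allFin-suc n f = cong (f zero +_) (∑-tabulate n suc f)

length-allFin : ∀ n → length (allFin n) ≡ n
length-allFin n = length-tabulate (λ u → u)

∑-allFin-δ : ∀ (v : Fin n) (g : Fin n → ℕ) → ∑ (allFin n) (λ u → 𝟙 (u == v) * g u) ≡ g v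
∑-allFin-δ {suc n} zero g = begin
  ∑ (allFin (suc n)) (λ u → 𝟙 (u == zero) * g u)  ≡⟨ ∑-allFin-suc n (λ u → 𝟙 (u == zero) * g u) ⟩
  g zero + 0 + ∑ (allFin n) (λ _ → 0)             ≡⟨ cong (g zero + 0 +_) (∑-zero (allFin n)) ⟩
  g zero + 0 + 0                                  ≡⟨ trans (+-identityʳ _) (+-identityʳ _) ⟩
  g zero                                          ∎
  where open ≡-Reasoning
∑-allFin-δ {suc n} (suc v) g =
  trans (∑-allFin-suc n (λ u → 𝟙 (u == suc v) * g u)) (∑-allFin-δ v (λ u → g (suc u)))

∣∣≡∑ : ∀ (S : Subset n) → ∣ S ∣ ≡ ∑ (allFin n) (λ u → 𝟙 (lookup S u))
∣∣≡∑ {zero}  []          = refl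
∣∣≡∑ {suc n} (b ∷ S) = trans (head+tail b) (sym (∑-allFin-suc n (λ u → 𝟙 (lookup (b ∷ S) u))))
  where
  head+tail : ∀ b → ∣ b ∷ S ∣ ≡ 𝟙 b + ∑ (allFin n) (λ u → 𝟙 (lookup S u))
  head+tail true  = cong suc (∣∣≡∑ S)
  head+tail false = ∣∣≡∑ S

fall : ℕ → ℕ → ℕ
fall a zero    = 1
fall a (suc j) = a * fall (a ∸ 1) j

shiftedSum : ℕ → ℕ → ℕ
shiftedSum c zero    = 0
shiftedSum c (suc j) = c + shiftedSum (suc c) j

shiftedSum-closed : ∀ c j → 2 * shiftedSum c j + j ≡ j * j + 2 * c * j
shiftedSum-closed c zero    = sym (*-zeroʳ (2 * c))
shiftedSum-closed c (suc j) = begin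
  2 * (c + shiftedSum (suc c) j) + suc j   ≡⟨ regroup c (shiftedSum (suc c) j) j ⟩
  2 * c + 1 + (2 * shiftedSum (suc c) j + j) ≡⟨ cong (2 * c + 1 +_) (shiftedSum-closed (suc c) j) ⟩
  2 * c + 1 + (j * j + 2 * suc c * j)       ≡⟨ expand c j ⟩
  suc j * suc j + 2 * c * suc j             ∎
  where
  open ≡-Reasoning
  regroup : ∀ c s j → 2 * (c + s) + suc j ≡ 2 * c + 1 + (2 * s + j)
  regroup = solve-∀
  expand : ∀ c j → 2 * c + 1 + (j * j + 2 * suc c * j) ≡ suc j * suc j + 2 * c * suc j
  expand = solve-∀

-- Weierstrass product inequality, cleared of denominators:
--   ∏_{i<j} (1 - (c+i)/L) ≥ 1 - (c + ⋯ + (c+j-1))/L   whenever c + j ≤ L.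
weierstrass : ∀ L c j → c + j ≤ L → L * L ^ j ≤ fall (L ∸ c) j * L + shiftedSum c j * L ^ j
weierstrass L c zero    _     = ≤-reflexive (trans (*-identityʳ L) (sym (trans (+-identityʳ _) (+-identityʳ L))))
weierstrass L c (suc j) c+j≤L = begin
  L * (L * L ^ j)                                  ≡⟨ cong (_* (L * L ^ j)) (sym (m∸n+n≡m c≤L)) ⟩
  (L ∸ c + c) * (L * L ^ j)                        ≡⟨ *-distribʳ-+ (L * L ^ j) (L ∸ c) c ⟩
  (L ∸ c) * (L * L ^ j) + c * (L * L ^ j)          ≤⟨ +-monoˡ-≤ _ (*-monoʳ-≤ (L ∸ c) IH) ⟩
  (L ∸ c) * (P * L + S * L ^ j) + c * (L * L ^ j)  ≡⟨ expand (L ∸ c) P L S (L ^ j) c ⟩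
  (L ∸ c) * P * L + (L ∸ c) * (S * L ^ j) + c * (L * L ^ j)
    ≤⟨ +-monoˡ-≤ _ (+-monoʳ-≤ ((L ∸ c) * P * L) (*-monoˡ-≤ (S * L ^ j) (m∸n≤m L c))) ⟩
  (L ∸ c) * P * L + L * (S * L ^ j) + c * (L * L ^ j) ≡⟨ collect (L ∸ c) P L S (L ^ j) c ⟩
  (L ∸ c) * P * L + (c + S) * (L * L ^ j)          ≡⟨ cong (λ z → (L ∸ c) * z * L + (c + S) * (L * L ^ j)) P≡ ⟩
  (L ∸ c) * fall (L ∸ c ∸ 1) j * L + (c + S) * (L * L ^ j) ∎
  where
  open ≤-Reasoning
  c≤L : c ≤ L
  c≤L = ≤-trans (m≤m+n c (suc j)) c+j≤L
  P : ℕ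
  P = fall (L ∸ suc c) j
  S : ℕ
  S = shiftedSum (suc c) j
  P≡ : P ≡ fall (L ∸ c ∸ 1) j
  P≡ = cong (λ z → fall z j) (trans (cong (L ∸_) (+-comm 1 c)) (sym (∸-+-assoc L c 1)))
  IH : L * L ^ j ≤ P * L + S * L ^ j
  IH = weierstrass L (suc c) j (≤-trans (≤-reflexive (sym (+-suc c j))) c+j≤L)
  expand : ∀ b P L S y c → b * (P * L + S * y) + c * (L * y) ≡ b * P * L + b * (S * y) + c * (L * y)
  expand = solve-∀
  collect : ∀ b P L S y c → b * P * L + L * (S * y) + c * (L * y) ≡ b * P * L + (c + S) * (L * y)
  collect = solve-∀

half-power≤fall : ∀ k → 1 ≤ k → (k * k) ^ k ≤ 2 * fall (k * k) k
half-power≤fall k k≥1 = *-cancelʳ-≤ ((k * k) ^ k) (2 * fall L k) L (+-cancelʳ-≤ (L ^ k * L) _ _ (begin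
  L ^ k * L + L ^ k * L                ≡⟨ double (L ^ k) L ⟩
  2 * (L * L ^ k)                      ≤⟨ *-monoʳ-≤ 2 (weierstrass L 0 k (m≤m*n k k)) ⟩
  2 * (fall L k * L + S * L ^ k)       ≡⟨ distribute (fall L k) L S (L ^ k) ⟩
  2 * fall L k * L + (2 * S) * L ^ k   ≤⟨ +-monoʳ-≤ (2 * fall L k * L) (*-monoˡ-≤ (L ^ k) 2S≤L) ⟩
  2 * fall L k * L + L * L ^ k         ≡⟨ cong (2 * fall L k * L +_) (*-comm L (L ^ k)) ⟩
  2 * fall L k * L + L ^ k * L         ∎))
  where
  open ≤-Reasoning
  L : ℕ
  L = k * k
  instance
    k≢0 : NonZero k
    k≢0 = >-nonZero k≥1
    L≢0 : NonZero L
    L≢0 = >-nonZero (*-mono-≤ k≥1 k≥1)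
  S : ℕ
  S = shiftedSum 0 k
  2S≤L : 2 * S ≤ L
  2S≤L = m+n≤o⇒m≤o (2 * S) (≤-reflexive (trans (shiftedSum-closed 0 k) (+-identityʳ L)))
  double : ∀ a b → a * b + a * b ≡ 2 * (b * a)
  double = solve-∀
  distribute : ∀ P L S y → 2 * (P * L + S * y) ≡ 2 * P * L + (2 * S) * y
  distribute = solve-∀

double≤⇒< : ∀ t Q → 2 * t ≤ Q → 0 < Q → t < Q
double≤⇒< zero    Q _  Q>0 = Q>0
double≤⇒< (suc t) Q 2t≤Q _ = <-≤-trans (m<m+n (suc t) (s≤s z≤n)) 2t≤Q

-- Bernoulli's inequality, cleared of denominators: (1 + d/a)^t ≥ 1 + t d/a.
bernoulli : ∀ a d t → a ^ t * (a + t * d) ≤ a * (a + d) ^ t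
bernoulli a d zero    = ≤-reflexive (trans (cong (_+ 0) (+-identityʳ a)) (trans (+-identityʳ a) (sym (*-identityʳ a))))
bernoulli a d (suc t) = begin
  a * a ^ t * (a + suc t * d)          ≤⟨ m≤m+n _ (a ^ t * (t * d * d)) ⟩
  a * a ^ t * (a + suc t * d) + a ^ t * (t * d * d) ≡⟨ expand a (a ^ t) d t ⟩
  (a + d) * (a ^ t * (a + t * d))      ≤⟨ *-monoʳ-≤ (a + d) (bernoulli a d t) ⟩
  (a + d) * (a * (a + d) ^ t)          ≡⟨ swap a d ((a + d) ^ t) ⟩
  a * ((a + d) * (a + d) ^ t)          ∎
  where
  open ≤-Reasoning
  expand : ∀ a y d t → a * y * (a + suc t * d) + y * (t * d * d) ≡ (a + d) * (y * (a + t * d))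
  expand = solve-∀
  swap : ∀ a d y → (a + d) * (a * y) ≡ a * ((a + d) * y)
  swap = solve-∀

^-distribʳ-* : ∀ a b e → (a * b) ^ e ≡ a ^ e * b ^ e
^-distribʳ-* a b zero    = refl
^-distribʳ-* a b (suc e) = trans (cong (a * b *_) (^-distribʳ-* a b e)) (interchange a b (a ^ e) (b ^ e))
  where
  interchange : ∀ a b c d → a * b * (c * d) ≡ a * c * (b * d)
  interchange = solve-∀

-- If D ≥ T/t then (1 - D/T)^t ≤ 1/2: the probability of avoiding an event of
-- probability D/T in t independent trials is at most one half.
avoid-t-trials : ∀ T D t → D ≤ T → T ≤ t * D → 1 ≤ t → 2 * (T ∸ D) ^ t ≤ T ^ t
avoid-t-trials T D (suc t) D≤T T≤tD _ with T ∸ D in eq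
... | zero   = z≤n
... | suc r = *-cancelˡ-≤ R (begin
    R * (2 * R ^ suc t)           ≡⟨ rearrange R (R ^ suc t) ⟩
    R ^ suc t * (R + R)           ≤⟨ *-monoʳ-≤ (R ^ suc t) (+-monoʳ-≤ R (≤-trans R≤T T≤tD)) ⟩
    R ^ suc t * (R + suc t * D)   ≤⟨ bernoulli R D (suc t) ⟩
    R * (R + D) ^ suc t           ≡⟨ cong (λ z → R * z ^ suc t) R+D≡T ⟩
    R * T ^ suc t                 ∎)
  where
  open ≤-Reasoning
  R : ℕ
  R = suc r
  R≤T : R ≤ T
  R≤T = subst (_≤ T) eq (m∸n≤m T D)
  R+D≡T : R + D ≡ T
  R+D≡T = trans (cong (_+ D) (sym eq)) (m∸n+n≡m D≤T)
  rearrange : ∀ a y → a * (2 * y) ≡ y * (a + a)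
  rearrange = solve-∀

avoid-many-trials : ∀ T D t e → D ≤ T → T ≤ t * D → 1 ≤ t →
  2 * (2 ^ e * (T ∸ D) ^ (t * suc e)) ≤ T ^ (t * suc e)
avoid-many-trials T D t e D≤T T≤tD t≥1 = begin
  2 * (2 ^ e * (T ∸ D) ^ (t * suc e))   ≡⟨ sym (*-assoc 2 (2 ^ e) _) ⟩
  2 ^ suc e * (T ∸ D) ^ (t * suc e)     ≡⟨ cong (2 ^ suc e *_) (sym (^-*-assoc (T ∸ D) t (suc e))) ⟩
  2 ^ suc e * ((T ∸ D) ^ t) ^ suc e     ≡⟨ sym (^-distribʳ-* 2 ((T ∸ D) ^ t) (suc e)) ⟩
  (2 * (T ∸ D) ^ t) ^ suc e             ≤⟨ ^-monoˡ-≤ (suc e) (avoid-t-trials T D t D≤T T≤tD t≥1) ⟩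
  (T ^ t) ^ suc e                       ≡⟨ ^-*-assoc T t (suc e) ⟩
  T ^ (t * suc e)                       ∎
  where open ≤-Reasoning

does≡true⇒ : ∀ {P : Set} (d : Dec P) → does d ≡ true → P
does≡true⇒ (yes p) _ = p

≢⇒differing-coordinate : DecidableEquality A → (u v : Vec A n) → u ≢ v → ∃[ j ] (lookup u j ≢ lookup v j)
≢⇒differing-coordinate _≟_ []      []      u≢v = ⊥-elim (u≢v refl)
≢⇒differing-coordinate _≟_ (a ∷ u) (b ∷ v) u≢v with a ≟ b
... | no  a≢b  = zero , a≢b
... | yes refl with ≢⇒differing-coordinate _≟_ u v (λ u≡v → u≢v (cong (a ∷_) u≡v))
...   | j , differ = suc j , differ

∣∣>0⇒nonempty : ∀ {n} (S : Subset n) → 0 < ∣ S ∣ → Nonempty S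
∣∣>0⇒nonempty {n} S ∣S∣>0 with nonempty? S
... | yes ne = ne
... | no  empty = contradiction (trans (cong ∣_∣ (Empty-unique empty)) (∣⊥∣≡0 n)) (>⇒≢ ∣S∣>0)

-- A colour assignment gives every vertex a colour in Colour x, i.e. it is a
-- family of x bicolorings read vertex by vertex.
ColourAssignment : ℕ → ℕ → Set
ColourAssignment x n = Vec (Colour x) n

assignments : ∀ x n → List (ColourAssignment x n)
assignments x n = allVec (colours x) n

length-assignments : ∀ x n → length (assignments x n) ≡ 2 ^ (x * n)
length-assignments x n = begin
  length (allVec (colours x) n)  ≡⟨ length-allVec (colours x) n ⟩
  length (colours x) ^ n         ≡⟨ cong (_^ n) (length-colours x) ⟩
  (2 ^ x) ^ n                    ≡⟨ ^-*-assoc 2 x n ⟩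
  2 ^ (x * n)                    ∎
  where open ≡-Reasoning

bicoloring : ∀ {x n} → ColourAssignment x n → Fin x → Bicoloring n
bicoloring χ j v = lookup (lookup χ v) j

assignmentOf : ∀ {x n} → (Fin x → Bicoloring n) → ColourAssignment x n
assignmentOf cs = tabulateᵥ (λ v → tabulateᵥ (λ j → cs j v))

bicoloring∘assignmentOf : ∀ {x n} (cs : Fin x → Bicoloring n) j v →
  bicoloring (assignmentOf cs) j v ≡ cs j v
bicoloring∘assignmentOf cs j v =
  trans (cong (λ c → lookup c j) (lookup∘tabulate (λ v → tabulateᵥ (λ j → cs j v)) v))
        (lookup∘tabulate (λ j → cs j v) j)

allColoured : ∀ {x} → ColourAssignment x n → Subset n → Colour x → Bool
allColoured []      []      c = true
allColoured (d ∷ χ) (b ∷ S) c = (not b ∨ (c ==ᶜ d)) ∧ allColoured χ S c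

count-allColoured : ∀ x n (S : Subset n) (c : Colour x) →
  ∑ (assignments x n) (λ χ → 𝟙 (allColoured χ S c)) * (2 ^ x) ^ ∣ S ∣ ≡ (2 ^ x) ^ n
count-allColoured x zero    []      c = refl
count-allColoured x (suc n) (b ∷ S) c = trans (cong (_* (q ^ ∣ b ∷ S ∣)) split) (by-membership b)
  where
  q : ℕ
  q = 2 ^ x
  K : ℕ
  K = ∑ (assignments x n) (λ χ → 𝟙 (allColoured χ S c))
  -- choices for the first vertex: any colour if it lies outside S, only c otherwise
  first : Bool → ℕ
  first b = ∑ (colours x) (λ d → 𝟙 (not b ∨ (c ==ᶜ d)))
  split : ∑ (assignments x (suc n)) (λ χ → 𝟙 (allColoured χ (b ∷ S) c)) ≡ first b * K
  split = begin
    ∑ (assignments x (suc n)) (λ χ → 𝟙 (allColoured χ (b ∷ S) c))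
      ≡⟨ ∑-allVec-suc (colours x) n _ ⟩
    ∑ (colours x) (λ d → ∑ (assignments x n) (λ χ → 𝟙 ((not b ∨ (c ==ᶜ d)) ∧ allColoured χ S c)))
      ≡⟨ ∑-cong (colours x) (λ d → ∑-cong (assignments x n) (λ χ → 𝟙-∧ (not b ∨ (c ==ᶜ d)) _)) ⟩
    ∑ (colours x) (λ d → ∑ (assignments x n) (λ χ → 𝟙 (not b ∨ (c ==ᶜ d)) * 𝟙 (allColoured χ S c)))
      ≡⟨ ∑-cong (colours x) (λ d →
           ∑-*ˡ (assignments x n) (𝟙 (not b ∨ (c ==ᶜ d))) (λ χ → 𝟙 (allColoured χ S c))) ⟩
    ∑ (colours x) (λ d → 𝟙 (not b ∨ (c ==ᶜ d)) * K)
      ≡⟨ ∑-*ʳ (colours x) K _ ⟩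
    first b * K ∎
    where open ≡-Reasoning
  by-membership : ∀ b → first b * K * q ^ ∣ b ∷ S ∣ ≡ q ^ suc n
  by-membership true = begin
    first true * K * (q * q ^ ∣ S ∣)  ≡⟨ cong (λ z → z * K * (q * q ^ ∣ S ∣)) (colours-exact x c) ⟩
    1 * K * (q * q ^ ∣ S ∣)           ≡⟨ rearrange K q (q ^ ∣ S ∣) ⟩
    q * (K * q ^ ∣ S ∣)               ≡⟨ cong (q *_) (count-allColoured x n S c) ⟩
    q * q ^ n                         ∎
    where
    open ≡-Reasoning
    rearrange : ∀ a b c → 1 * a * (b * c) ≡ b * (a * c)
    rearrange = solve-∀
  by-membership false = begin
    first false * K * q ^ ∣ S ∣       ≡⟨ cong (λ z → z * K * q ^ ∣ S ∣) #colours ⟩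
    q * K * q ^ ∣ S ∣                 ≡⟨ *-assoc q K _ ⟩
    q * (K * q ^ ∣ S ∣)               ≡⟨ cong (q *_) (count-allColoured x n S c) ⟩
    q * q ^ n                         ∎
    where
    open ≡-Reasoning
    #colours : first false ≡ q
    #colours = trans (sym (length≡∑1 (colours x))) (length-colours x)

allColoured≡false⇒witness : ∀ {x} (χ : ColourAssignment x n) (S : Subset n) c → allColoured χ S c ≡ false →
  ∃[ v ] (v ∈ₛ S × c ≢ lookup χ v)
allColoured≡false⇒witness []      []         c ()
allColoured≡false⇒witness (d ∷ χ) (true ∷ S) c notAll with c ≟ᶜ d
... | no c≢d = zero , hereₛ , c≢d
... | yes _ with allColoured≡false⇒witness χ S c notAll
...   | v , v∈S , c≢χv = suc v , thereₛ v∈S , c≢χv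
allColoured≡false⇒witness (d ∷ χ) (false ∷ S) c notAll with allColoured≡false⇒witness χ S c notAll
... | v , v∈S , c≢χv = suc v , thereₛ v∈S , c≢χv

module LowerBound {k x n m : ℕ} (E : Hyperedges n m) (uniform : ∀ i → ∣ E i ∣ ≡ k) where

  monochromaticPairs : ColourAssignment x n → ℕ
  monochromaticPairs χ = ∑ (allFin m) (λ i → ∑ (colours x) (λ c → 𝟙 (allColoured χ (E i) c)))

  -- Double counting: each pair is monochromatic under a fraction (2^x)^{-k} of the assignments.
  ∑-monochromaticPairs : ∑ (assignments x n) monochromaticPairs * (2 ^ x) ^ k ≡ m * (2 ^ x * (2 ^ x) ^ n)
  ∑-monochromaticPairs = begin
    ∑ χs monochromaticPairs * Q ^ k
      ≡⟨ cong (_* Q ^ k) (trans (∑-swap χs (allFin m) _) (∑-cong (allFin m) (λ i → ∑-swap χs (colours x) _))) ⟩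
    ∑ (allFin m) (λ i → ∑ (colours x) (count i)) * Q ^ k
      ≡⟨ sym (∑-*ʳ (allFin m) _ _) ⟩
    ∑ (allFin m) (λ i → ∑ (colours x) (count i) * Q ^ k)
      ≡⟨ ∑-cong (allFin m) (λ i → sym (∑-*ʳ (colours x) _ _)) ⟩
    ∑ (allFin m) (λ i → ∑ (colours x) (λ c → count i c * Q ^ k))
      ≡⟨ ∑-cong (allFin m) (λ i → ∑-cong (colours x) (λ c →
           trans (cong (λ z → count i c * Q ^ z) (sym (uniform i))) (count-allColoured x n (E i) c))) ⟩
    ∑ (allFin m) (λ i → ∑ (colours x) (λ _ → Q ^ n))
      ≡⟨ ∑-cong (allFin m) (λ i → ∑-const (colours x) _) ⟩
    ∑ (allFin m) (λ i → length (colours x) * Q ^ n)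
      ≡⟨ ∑-const (allFin m) _ ⟩
    length (allFin m) * (length (colours x) * Q ^ n)
      ≡⟨ cong₂ (λ a b → a * (b * Q ^ n)) (length-allFin m) (length-colours x) ⟩
    m * (Q * Q ^ n) ∎
    where
    open ≡-Reasoning
    Q : ℕ
    Q = 2 ^ x
    χs : List (ColourAssignment x n)
    χs = assignments x n
    count : Fin m → Colour x → ℕ
    count i c = ∑ χs (λ χ → 𝟙 (allColoured χ (E i) c))

  -- An assignment without monochromatic pairs makes its x bicolorings a cover
  -- (edges are nonempty, so a monochromatic edge would have some colour).
  noPairs⇒cover : 1 ≤ k → ∀ χ → monochromaticPairs χ ≡ 0 → IsBicoloringCover (bicoloring χ) E
  noPairs⇒cover k≥1 χ none i with ∣∣>0⇒nonempty (E i) (subst (0 <_) (sym (uniform i)) k≥1)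
  ... | u , u∈Ei with allColoured≡false⇒witness χ (E i) (lookup χ u) (𝟙≡0⇒false
        (∑≡0⇒term≡0 (colours x) _ (∑≡0⇒term≡0 (allFin m) _ none (∈-allFin i)) (∈-colours (lookup χ u))))
  ...   | v , v∈Ei , χu≢χv with ≢⇒differing-coordinate Boolₚ._≟_ (lookup χ u) (lookup χ v) χu≢χv
  ...     | j , differ = j , u , v , u∈Ei , v∈Ei , differ

  few-edges⇒few-pairs : 2 * m * 2 ^ x ≤ (2 ^ x) ^ k →
    ∑ (assignments x n) monochromaticPairs < length (assignments x n)
  few-edges⇒few-pairs few = subst (total <_) (sym (trans (length-assignments x n) (sym (^-*-assoc 2 x n))))
    (double≤⇒< total (Q ^ n) (*-cancelʳ-≤ (2 * total) (Q ^ n) (Q ^ k) (begin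
      2 * total * Q ^ k          ≡⟨ trans (*-assoc 2 total (Q ^ k)) (cong (2 *_) ∑-monochromaticPairs) ⟩
      2 * (m * (Q * Q ^ n))      ≡⟨ regroup m Q (Q ^ n) ⟩
      2 * m * Q * Q ^ n          ≤⟨ *-monoˡ-≤ (Q ^ n) few ⟩
      Q ^ k * Q ^ n              ≡⟨ *-comm (Q ^ k) (Q ^ n) ⟩
      Q ^ n * Q ^ k              ∎))
      (m^n>0 Q n))
    where
    open ≤-Reasoning
    Q : ℕ
    Q = 2 ^ x
    instance
      Q≢0 : NonZero Q
      Q≢0 = m^n≢0 2 x
      Qᵏ≢0 : NonZero (Q ^ k)
      Qᵏ≢0 = m^n≢0 Q k
    total : ℕ
    total = ∑ (assignments x n) monochromaticPairs
    regroup : ∀ a b c → 2 * (a * (b * c)) ≡ 2 * a * b * c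
    regroup = solve-∀

  few-edges⇒cover : 1 ≤ k → 2 * m * 2 ^ x ≤ (2 ^ x) ^ k → HasCoverOfSize x E
  few-edges⇒cover k≥1 few with ∑<length⇒term≡0 (assignments x n) monochromaticPairs (few-edges⇒few-pairs few)
  ... | χ , _ , none = bicoloring χ , noPairs⇒cover k≥1 χ none

few-edges : ∀ k x m → 2 ≤ k → 1 ≤ x → m ≤ 2 ^ ((k ∸ 1) * x ∸ 1) → 2 * m * 2 ^ x ≤ (2 ^ x) ^ k
few-edges (suc k) x m (s≤s k≥1) x≥1 m≤ = begin
  2 * m * 2 ^ x                  ≤⟨ *-monoˡ-≤ (2 ^ x) (*-monoʳ-≤ 2 m≤) ⟩
  2 * 2 ^ (k * x ∸ 1) * 2 ^ x    ≡⟨ cong (λ e → 2 ^ e * 2 ^ x) (m+[n∸m]≡n kx≥1) ⟩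
  2 ^ (k * x) * 2 ^ x            ≡⟨ sym (^-distribˡ-+-* 2 (k * x) x) ⟩
  2 ^ (k * x + x)                ≡⟨ cong (2 ^_) (+-comm (k * x) x) ⟩
  2 ^ (suc k * x)                ≡⟨ cong (2 ^_) (*-comm (suc k) x) ⟩
  2 ^ (x * suc k)                ≡⟨ sym (^-*-assoc 2 x (suc k)) ⟩
  (2 ^ x) ^ suc k                ∎
  where
  open ≤-Reasoning
  kx≥1 : 1 ≤ k * x
  kx≥1 = *-mono-≤ k≥1 x≥1

lowerBound : ∀ k x → 2 ≤ k → 1 ≤ x → ∀ m → Witnesses-m k x m → 2 ^ ((k ∸ 1) * x ∸ 1) < m
lowerBound k x k≥2 x≥1 m (n , E , (_ , uniform) , noCover) with 2 ^ ((k ∸ 1) * x ∸ 1) <? m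
... | yes many = many
... | no  few  = ⊥-elim (noCover (LowerBound.few-edges⇒cover E uniform (≤-trans (s≤s z≤n) k≥2)
                   (few-edges k x m k≥2 x≥1 (≮⇒≥ few))))

-- Tuples of vertices and boolean predicates on vertices.  A tuple is counted
-- as a candidate edge when its entries are distinct.
Tuple : ℕ → ℕ → Set
Tuple n j = Vec (Fin n) j

allB : ∀ {j} → (Fin n → Bool) → Tuple n j → Bool
allB p []      = true
allB p (v ∷ t) = p v ∧ allB p t

occurs : ∀ {j} → Fin n → Tuple n j → Bool
occurs u []      = false
occurs u (w ∷ t) = (u == w) ∨ occurs u t

distinct : ∀ {j} → Tuple n j → Bool
distinct []      = true
distinct (v ∷ t) = allB (λ u → not (u == v)) t ∧ distinct t

allB-∧ : ∀ {j} (p r : Fin n → Bool) (t : Tuple n j) → allB (λ u → p u ∧ r u) t ≡ allB p t ∧ allB r t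
allB-∧ p r []      = refl
allB-∧ p r (v ∷ t) = trans (cong ((p v ∧ r v) ∧_) (allB-∧ p r t)) (interchange (p v) (r v) (allB p t) (allB r t))
  where
  open ∨-∧-Solver
  interchange : ∀ a b c d → (a ∧ b) ∧ (c ∧ d) ≡ (a ∧ c) ∧ (b ∧ d)
  interchange = solve 4 (λ a b c d → (a :* b) :* (c :* d) := (a :* c) :* (b :* d)) refl

size : (Fin n → Bool) → ℕ
size {n} p = ∑ (allFin n) (λ u → 𝟙 (p u))

without : (Fin n → Bool) → Fin n → Fin n → Bool
without p v u = p u ∧ not (u == v)

size-without : ∀ (p : Fin n → Bool) v → p v ≡ true → size p ≡ suc (size (without p v))
size-without {n} p v pv = begin
  size p                                                 ≡⟨ ∑-cong (allFin n) (λ u → split (p u) (u == v)) ⟩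
  ∑ (allFin n) (λ u → 𝟙 (without p v u) + 𝟙 (u == v) * 𝟙 (p u))
      ≡⟨ ∑-+ (allFin n) _ _ ⟩
  size (without p v) + ∑ (allFin n) (λ u → 𝟙 (u == v) * 𝟙 (p u))
      ≡⟨ cong (size (without p v) +_) (∑-allFin-δ v (λ u → 𝟙 (p u))) ⟩
  size (without p v) + 𝟙 (p v)                           ≡⟨ cong (λ b → size (without p v) + 𝟙 b) pv ⟩
  size (without p v) + 1                                 ≡⟨ +-comm (size (without p v)) 1 ⟩
  suc (size (without p v))                               ∎
  where
  open ≡-Reasoning
  split : ∀ b e → 𝟙 b ≡ 𝟙 (b ∧ not e) + 𝟙 e * 𝟙 b
  split true  true  = refl
  split true  false = refl
  split false true  = refl
  split false false = refl

distinctTuplesIn : (Fin n → Bool) → ℕ → ℕ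
distinctTuplesIn {n} p j = ∑ (allVec (allFin n) j) (λ t → 𝟙 (distinct t ∧ allB p t))

distinctTuplesIn-suc : ∀ (p : Fin n → Bool) j →
  distinctTuplesIn p (suc j) ≡ ∑ (allFin n) (λ v → 𝟙 (p v) * distinctTuplesIn (without p v) j)
distinctTuplesIn-suc {n} p j = trans (∑-allVec-suc (allFin n) j _)
  (∑-cong (allFin n) (λ v → trans (∑-cong (allVec (allFin n) j) (first-entry v))
    (∑-*ˡ (allVec (allFin n) j) (𝟙 (p v)) (λ t → 𝟙 (distinct t ∧ allB (without p v) t)))))
  where
  open ∨-∧-Solver
  rearrange : ∀ a d b c → (a ∧ d) ∧ (b ∧ c) ≡ b ∧ (d ∧ (c ∧ a))
  rearrange = solve 4 (λ a d b c → (a :* d) :* (b :* c) := b :* (d :* (c :* a))) refl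
  first-entry : ∀ v t →
    𝟙 (distinct (v ∷ t) ∧ allB p (v ∷ t)) ≡ 𝟙 (p v) * 𝟙 (distinct t ∧ allB (without p v) t)
  first-entry v t = trans (cong 𝟙 (trans (rearrange (allB (λ u → not (u == v)) t) (distinct t) (p v) (allB p t))
                     (cong (λ z → p v ∧ (distinct t ∧ z)) (sym (allB-∧ p (λ u → not (u == v)) t)))))
                    (𝟙-∧ (p v) _)

fall≤distinctTuplesIn : ∀ j (p : Fin n → Bool) a → a ≤ size p → fall a j ≤ distinctTuplesIn p j
fall≤distinctTuplesIn zero    p a a≤ = s≤s z≤n
fall≤distinctTuplesIn {n} (suc j) p a a≤ = begin
  a * fall (a ∸ 1) j                                          ≤⟨ *-monoˡ-≤ (fall (a ∸ 1) j) a≤ ⟩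
  size p * fall (a ∸ 1) j                                     ≡⟨ sym (∑-*ʳ (allFin n) (fall (a ∸ 1) j) _) ⟩
  ∑ (allFin n) (λ v → 𝟙 (p v) * fall (a ∸ 1) j)               ≤⟨ ∑-mono (allFin n) per-vertex ⟩
  ∑ (allFin n) (λ v → 𝟙 (p v) * distinctTuplesIn (without p v) j) ≡⟨ sym (distinctTuplesIn-suc p j) ⟩
  distinctTuplesIn p (suc j)                                  ∎
  where
  open ≤-Reasoning
  per-vertex : ∀ v → 𝟙 (p v) * fall (a ∸ 1) j ≤ 𝟙 (p v) * distinctTuplesIn (without p v) j
  per-vertex v with p v in pv
  ... | false = z≤n
  ... | true  = +-monoˡ-≤ 0 (fall≤distinctTuplesIn j (without p v) (a ∸ 1)
                  (∸-monoˡ-≤ 1 (subst (a ≤_) (size-without p v pv) a≤)))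

support : ∀ {j} → Tuple n j → Subset n
support t = tabulateᵥ (λ u → occurs u t)

first∉rest : ∀ {j} (v : Fin n) (t : Tuple n j) →
  allB (λ w → not (w == v)) t ≡ true → occurs v t ≡ false
first∉rest v []      _    = refl
first∉rest v (w ∷ t) rest with w Fin.≟ v | v Fin.≟ w
... | yes _    | _        = contradiction rest (λ ())
... | no  w≢v  | yes v≡w  = contradiction (sym v≡w) w≢v
... | no  _    | no  _    = first∉rest v t rest

∣support∣ : ∀ {j} (t : Tuple n j) → distinct t ≡ true → ∣ support t ∣ ≡ j
∣support∣ {n} t d = trans (∣∣≡∑ (support t))
  (trans (∑-cong (allFin n) (λ u → cong 𝟙 (lookup∘tabulate (λ u → occurs u t) u)))
         (count-entries t d))
  where
  count-entries : ∀ {j} (t : Tuple n j) → distinct t ≡ true →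
    ∑ (allFin n) (λ u → 𝟙 (occurs u t)) ≡ j
  count-entries []      _ = ∑-zero (allFin n)
  count-entries (v ∷ t) d with ∧-split {allB (λ u → not (u == v)) t} d
  ... | fresh , d-rest = begin
    ∑ (allFin n) (λ u → 𝟙 ((u == v) ∨ occurs u t))
      ≡⟨ ∑-cong (allFin n) disjoint ⟩
    ∑ (allFin n) (λ u → 𝟙 (u == v) * 1 + 𝟙 (occurs u t))
      ≡⟨ ∑-+ (allFin n) _ _ ⟩
    ∑ (allFin n) (λ u → 𝟙 (u == v) * 1) + ∑ (allFin n) (λ u → 𝟙 (occurs u t))
      ≡⟨ cong₂ _+_ (∑-allFin-δ v (λ _ → 1)) (count-entries t d-rest) ⟩
    suc _ ∎
    where
    open ≡-Reasoning
    disjoint : ∀ u → 𝟙 ((u == v) ∨ occurs u t)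
                     ≡ 𝟙 (u == v) * 1 + 𝟙 (occurs u t)
    disjoint u with u Fin.≟ v
    ... | yes refl = cong (λ b → 1 + 𝟙 b) (sym (first∉rest u t fresh))
    ... | no  _    = refl

support⊆ : ∀ {j} (p : Fin n → Bool) u (t : Tuple n j) → u ∈ₛ support t → allB p t ≡ true → p u ≡ true
support⊆ p u t u∈ all = entries p t (trans (sym (lookup∘tabulate (λ u → occurs u t) u)) ([]=⇒lookup u∈)) all
  where
  entries : ∀ {j} (p : Fin _ → Bool) (t : Tuple _ j) → occurs u t ≡ true → allB p t ≡ true → p u ≡ true
  entries p (w ∷ t) any all with ∧-split {p w} all | u Fin.≟ w
  ... | pw , _    | yes refl = pw
  ... | _ , prest | no  _    = entries p t any prest

colourClass : ∀ {x} → ColourAssignment x n → Colour x → Fin n → Bool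
colourClass χ c u = does (lookup χ u ≟ᶜ c)

Unavoidable : ∀ {k m} → ℕ → Vec (Tuple n k) m → Set
Unavoidable {n} x s = ∀ (χ : ColourAssignment x n) →
  ∃[ i ] ∃[ c ] (distinct (lookup s i) ∧ allB (colourClass χ c) (lookup s i) ≡ true)

module RandomTuples (k x : ℕ) (k≥2 : 2 ≤ k) (x≥1 : 1 ≤ x) where

  q L N T D t m : ℕ
  q = 2 ^ x
  L = k * k                -- size guaranteed for some colour class
  N = q * L
  T = N ^ k
  D = fall L k             -- distinct tuples inside a class of size L
  t = 2 * q ^ k            -- trials that halve the probability of missing
  m = t * suc (x * N)

  instance
    q≢0 : NonZero q
    q≢0 = m^n≢0 2 x

  k≥1 : 1 ≤ k
  k≥1 = ≤-trans (s≤s z≤n) k≥2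

  N≥1 : 1 ≤ N
  N≥1 = *-mono-≤ (m^n>0 2 x) (*-mono-≤ k≥1 k≥1)

  tuples : List (Tuple N k)
  tuples = allVec (allFin N) k

  #tuples : ∑ tuples (λ _ → 1) ≡ T
  #tuples = begin
    ∑ tuples (λ _ → 1)   ≡⟨ sym (length≡∑1 tuples) ⟩
    length tuples        ≡⟨ length-allVec (allFin N) k ⟩
    length (allFin N) ^ k ≡⟨ cong (_^ k) (length-allFin N) ⟩
    T                    ∎
    where open ≡-Reasoning

  -- Pigeonhole: the q colour classes partition the N = q L vertices.
  large-class : ∀ (χ : ColourAssignment x N) → ∃[ c ] (L ≤ size (colourClass χ c))
  large-class χ = pigeonhole (colours x) (λ c → size (colourClass χ c)) L
    (subst (0 <_) (sym (length-colours x)) (m^n>0 2 x))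
    (≤-reflexive (begin
      length (colours x) * L   ≡⟨ cong (_* L) (length-colours x) ⟩
      N                        ≡⟨ sym (length-allFin N) ⟩
      length (allFin N)        ≡⟨ length≡∑1 (allFin N) ⟩
      ∑ (allFin N) (λ _ → 1)   ≡⟨ ∑-cong (allFin N) (λ u → sym (colours-exact x (lookup χ u))) ⟩
      ∑ (allFin N) (λ u → ∑ (colours x) (λ c → 𝟙 (colourClass χ c u)))
                               ≡⟨ ∑-swap (allFin N) (colours x) _ ⟩
      ∑ (colours x) (λ c → size (colourClass χ c)) ∎))
    where open ≡-Reasoning

  monochromatic : ColourAssignment x N → Colour x → Tuple N k → ℕ
  monochromatic χ c s = 𝟙 (distinct s ∧ allB (colourClass χ c) s)

  misses : ColourAssignment x N → Tuple N k → ℕ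
  misses χ s = 1 ∸ ∑ (colours x) (λ c → monochromatic χ c s)

  ∑-monochromatic≤T : ∀ χ c → ∑ tuples (monochromatic χ c) ≤ T
  ∑-monochromatic≤T χ c = subst (∑ tuples (monochromatic χ c) ≤_) #tuples (∑-mono tuples (λ s → 𝟙≤1 _))

  -- At most T - D tuples miss, as a colour class of size ≥ L holds D distinct tuples.
  ∑-misses≤ : ∀ χ → ∑ tuples (misses χ) ≤ T ∸ D
  ∑-misses≤ χ with large-class χ
  ... | c , L≤ = m+n≤o⇒m≤o∸n (∑ tuples (misses χ)) (begin
    ∑ tuples (misses χ) + D
      ≤⟨ +-mono-≤ (∑-mono tuples misses≤) (fall≤distinctTuplesIn k (colourClass χ c) L L≤) ⟩
    ∑ tuples (λ s → 1 ∸ monochromatic χ c s) + ∑ tuples (monochromatic χ c)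
      ≡⟨ sym (∑-+ tuples _ _) ⟩
    ∑ tuples (λ s → 1 ∸ monochromatic χ c s + monochromatic χ c s)
      ≡⟨ ∑-cong tuples (λ s → m∸n+n≡m (𝟙≤1 (distinct s ∧ allB (colourClass χ c) s))) ⟩
    ∑ tuples (λ _ → 1)
      ≡⟨ #tuples ⟩
    T ∎)
    where
    open ≤-Reasoning
    misses≤ : ∀ s → misses χ s ≤ 1 ∸ monochromatic χ c s
    misses≤ s = ∸-monoʳ-≤ 1 (term≤∑ (colours x) (λ c → monochromatic χ c s) (∈-colours c))

  D≤T : D ≤ T
  D≤T = ≤-trans (fall≤distinctTuplesIn k (colourClass χ₀ c) L L≤) (∑-monochromatic≤T χ₀ c)
    where
    χ₀ : ColourAssignment x N
    χ₀ = replicate N (replicate x false)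
    c : Colour x
    c = proj₁ (large-class χ₀)
    L≤ : L ≤ size (colourClass χ₀ c)
    L≤ = proj₂ (large-class χ₀)

  T≤tD : T ≤ t * D
  T≤tD = begin
    T                    ≡⟨ ^-distribʳ-* q L k ⟩
    q ^ k * L ^ k        ≤⟨ *-monoʳ-≤ (q ^ k) (half-power≤fall k k≥1) ⟩
    q ^ k * (2 * D)      ≡⟨ rearrange (q ^ k) D ⟩
    t * D                ∎
    where
    open ≤-Reasoning
    rearrange : ∀ a b → a * (2 * b) ≡ 2 * a * b
    rearrange = solve-∀

  t≥1 : 1 ≤ t
  t≥1 = ≤-trans (m^n>0 q k) (m≤m+n (q ^ k) _)

  sequences : List (Vec (Tuple N k) m)
  sequences = allVec tuples m

  allMiss : Vec (Tuple N k) m → ℕ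
  allMiss s = ∑ (assignments x N) (λ χ → ∏ (misses χ) s)

  -- Union bound over the assignments, each avoided by ≤ (T - D)^m sequences.
  ∑-allMiss≤ : ∑ sequences allMiss ≤ 2 ^ (x * N) * (T ∸ D) ^ m
  ∑-allMiss≤ = begin
    ∑ sequences allMiss                       ≡⟨ ∑-swap sequences χs _ ⟩
    ∑ χs (λ χ → ∑ sequences (∏ (misses χ)))   ≡⟨ ∑-cong χs (λ χ → ∑-∏ tuples m (misses χ)) ⟩
    ∑ χs (λ χ → ∑ tuples (misses χ) ^ m)      ≤⟨ ∑-mono χs (λ χ → ^-monoˡ-≤ m (∑-misses≤ χ)) ⟩
    ∑ χs (λ _ → (T ∸ D) ^ m)                  ≡⟨ ∑-const χs _ ⟩
    length χs * (T ∸ D) ^ m                   ≡⟨ cong (_* (T ∸ D) ^ m) (length-assignments x N) ⟩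
    2 ^ (x * N) * (T ∸ D) ^ m                 ∎
    where
    open ≤-Reasoning
    χs : List (ColourAssignment x N)
    χs = assignments x N

  ∑-allMiss< : ∑ sequences allMiss < length sequences
  ∑-allMiss< = subst (∑ sequences allMiss <_) (sym #sequences)
    (≤-<-trans ∑-allMiss≤ (double≤⇒< _ (T ^ m) (avoid-many-trials T D t (x * N) D≤T T≤tD t≥1) T^m>0))
    where
    #sequences : length sequences ≡ T ^ m
    #sequences = trans (length-allVec tuples m) (cong (_^ m) (trans (length≡∑1 tuples) #tuples))
    T^m>0 : 0 < T ^ m
    T^m>0 = subst (_≤ T ^ m) (^-zeroˡ m) (^-monoˡ-≤ m (subst (_≤ T) (^-zeroˡ k) (^-monoˡ-≤ k N≥1)))

  unavoidable : ∃[ s ] Unavoidable x s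
  unavoidable with ∑<length⇒term≡0 sequences allMiss ∑-allMiss<
  ... | s , _ , none = s , hit
    where
    hit : Unavoidable x s
    hit χ with ∏≡0⇒factor≡0 (misses χ) s
                 (∑≡0⇒term≡0 (assignments x N) _ none (∈-allVec (colours x) ∈-colours χ))
    ... | i , missᵢ≡0 with ∑>0⇒term>0 (colours x) (λ c → monochromatic χ c (lookup s i))
                                        (m∸n≡0⇒m≤n missᵢ≡0)
    ...   | c , _ , mono = i , c , 𝟙>0⇒true mono

lookup-injective : ∀ (l : List A) → Unique l → Injective _≡_ _≡_ (List.lookup l)
lookup-injective (a ∷ l) (a∉l ∷ unique) {zero}  {zero}  _ = refl
lookup-injective (a ∷ l) (a∉l ∷ unique) {zero}  {suc j} e = contradiction e (All.lookup a∉l (∈-lookup j))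
lookup-injective (a ∷ l) (a∉l ∷ unique) {suc i} {zero}  e = contradiction (sym e) (All.lookup a∉l (∈-lookup i))
lookup-injective (a ∷ l) (a∉l ∷ unique) {suc i} {suc j} e = cong suc (lookup-injective l unique e)

_≟ₛ_ : DecidableEquality (Subset n)
_≟ₛ_ = ≡-dec Boolₚ._≟_

-- The hypergraph spanned by a sequence of k-tuples: its edges are the supports
-- of the tuples with distinct entries, each listed once.
module FromTuples {N k : ℕ} where

  candidates : ∀ {m} → Vec (Tuple N k) m → List (Subset N)
  candidates []      = []
  candidates (t ∷ s) = if distinct t then support t ∷ candidates s else candidates s

  candidates-uniform : ∀ {m} (s : Vec (Tuple N k) m) {S} → S ∈ candidates s → ∣ S ∣ ≡ k
  candidates-uniform (t ∷ s) S∈ with distinct t in d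
  candidates-uniform (t ∷ s) (here refl) | true  = ∣support∣ t d
  candidates-uniform (t ∷ s) (there S∈)  | true  = candidates-uniform s S∈
  candidates-uniform (t ∷ s) S∈          | false = candidates-uniform s S∈

  candidates-complete : ∀ {m} (s : Vec (Tuple N k) m) i →
    distinct (lookup s i) ≡ true → support (lookup s i) ∈ candidates s
  candidates-complete (t ∷ s) zero    d rewrite d = here refl
  candidates-complete (t ∷ s) (suc i) d with distinct t
  ... | true  = there (candidates-complete s i d)
  ... | false = candidates-complete s i d

  length-candidates : ∀ {m} (s : Vec (Tuple N k) m) → length (candidates s) ≤ m
  length-candidates []      = z≤n
  length-candidates (t ∷ s) with distinct t
  ... | true  = s≤s (length-candidates s)
  ... | false = m≤n⇒m≤1+n (length-candidates s)

  edges : ∀ {m} → Vec (Tuple N k) m → List (Subset N)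
  edges s = deduplicate _≟ₛ_ (candidates s)

  hypergraph : ∀ {m} (s : Vec (Tuple N k) m) → Hyperedges N (length (edges s))
  hypergraph s = List.lookup (edges s)

  uniform : ∀ {m} (s : Vec (Tuple N k) m) → IsUniformHypergraph k (hypergraph s)
  uniform s = lookup-injective (edges s) (deduplicate-! _≟ₛ_ (candidates s))
            , λ e → candidates-uniform s (∈-deduplicate⁻ _≟ₛ_ (candidates s) (∈-lookup e))

  length-edges : ∀ {m} (s : Vec (Tuple N k) m) → length (edges s) ≤ m
  length-edges s = ≤-trans (length-deduplicate _≟ₛ_ (candidates s)) (length-candidates s)

  monochromaticEdge : ∀ {x m} (s : Vec (Tuple N k) m) (χ : ColourAssignment x N) i c →
    distinct (lookup s i) ∧ allB (colourClass χ c) (lookup s i) ≡ true →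
    ∃[ e ] (∀ w → w ∈ₛ hypergraph s e → lookup χ w ≡ c)
  monochromaticEdge s χ i c mono with ∧-split {distinct (lookup s i)} mono
  ... | d , inClass = index e∈edges , λ w w∈ → does≡true⇒ (lookup χ w ≟ᶜ c)
        (support⊆ (colourClass χ c) w (lookup s i) (subst (w ∈ₛ_) (sym (lookup-index e∈edges)) w∈) inClass)
    where
    e∈edges : support (lookup s i) ∈ edges s
    e∈edges = ∈-deduplicate⁺ _≟ₛ_ (candidates-complete s i d)

  unavoidable⇒noCover : ∀ {x m} (s : Vec (Tuple N k) m) → Unavoidable x s → ¬ HasCoverOfSize x (hypergraph s)
  unavoidable⇒noCover s unavoid (cs , cover) with unavoid (assignmentOf cs)
  ... | i , c , mono with monochromaticEdge s (assignmentOf cs) i c mono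
  ... | e , allC with cover e
  ... | j , u , v , u∈ , v∈ , differ = differ (trans (colour u u∈) (sym (colour v v∈)))
    where
    colour : ∀ w → w ∈ₛ hypergraph s e → cs j w ≡ lookup c j
    colour w w∈ = trans (sym (bicoloring∘assignmentOf cs j w)) (cong (λ c′ → lookup c′ j) (allC w w∈))

tupleCount≤ : ∀ k x → 1 ≤ k → 1 ≤ x →
  2 * (2 ^ x) ^ k * suc (x * (2 ^ x * (k * k))) ≤ x * k ^ 2 * 2 ^ ((k + 1) * x + 2)
tupleCount≤ k x k≥1 x≥1 = begin
  2 * Q * suc M                      ≡⟨ split Q M ⟩
  2 * Q * M + 2 * Q * 1              ≤⟨ +-monoʳ-≤ (2 * Q * M) (*-monoʳ-≤ (2 * Q) M≥1) ⟩
  2 * Q * M + 2 * Q * M              ≡⟨ collect Q x q k ⟩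
  x * (k * (k * 1)) * (q * Q * 4)    ≡⟨ cong (λ z → x * (k * (k * 1)) * (z * 4)) qQ≡ ⟩
  x * k ^ 2 * (2 ^ ((k + 1) * x) * 2 ^ 2) ≡⟨ cong (x * k ^ 2 *_) (sym (^-distribˡ-+-* 2 ((k + 1) * x) 2)) ⟩
  x * k ^ 2 * 2 ^ ((k + 1) * x + 2)  ∎
  where
  open ≤-Reasoning
  q : ℕ
  q = 2 ^ x
  Q : ℕ
  Q = q ^ k
  M : ℕ
  M = x * (q * (k * k))
  M≥1 : 1 ≤ M
  M≥1 = *-mono-≤ x≥1 (*-mono-≤ (m^n>0 2 x) (*-mono-≤ k≥1 k≥1))
  qQ≡ : q * Q ≡ 2 ^ ((k + 1) * x)
  qQ≡ = trans (^-*-assoc 2 x (suc k)) (cong (2 ^_) (trans (*-comm x (suc k)) (cong (_* x) (+-comm 1 k))))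
  split : ∀ a b → 2 * a * suc b ≡ 2 * a * b + 2 * a * 1
  split = solve-∀
  collect : ∀ Q x q k →
    2 * Q * (x * (q * (k * k))) + 2 * Q * (x * (q * (k * k))) ≡ x * (k * (k * 1)) * (q * Q * 4)
  collect = solve-∀

upperBound : ∀ k x → 2 ≤ k → 1 ≤ x → ∃[ m ] (m ≤ x * k ^ 2 * 2 ^ ((k + 1) * x + 2) × Witnesses-m k x m)
upperBound k x k≥2 x≥1 =
  length (edges s) , size≤ , N , hypergraph s , uniform s , unavoidable⇒noCover s unavoid
  where
  open FromTuples
  open RandomTuples k x k≥2 x≥1 using (N; m; unavoidable)
  s : Vec (Tuple N k) m
  s = proj₁ unavoidable
  unavoid : Unavoidable x s
  unavoid = proj₂ unavoidable
  size≤ : length (edges s) ≤ x * k ^ 2 * 2 ^ ((k + 1) * x + 2)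
  size≤ = ≤-trans (length-edges s) (tupleCount≤ k x (≤-trans (s≤s z≤n) k≥2) x≥1)

theorem12 : ∀ (k x : ℕ) → 2 ≤ k → 1 ≤ x →
    (∀ m → Witnesses-m k x m → 2 ^ ((k ∸ 1) * x ∸ 1) < m)
    × (∃[ m ] (m ≤ x * k ^ 2 * 2 ^ ((k + 1) * x + 2) × Witnesses-m k x m))
theorem12 k x k≥2 x≥1 = lowerBound k x k≥2 x≥1 , upperBound k x k≥2 x≥1
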